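{- Every interval graph is a $\Delta$-disk graph. Moreover, there exists a $\Delta$-disk graph that is not an interval graph.
   Context: An interval graph is the intersection graph of a finite family of intervals of the real line. A $\Delta$-disk graph is a graph having a representation as the intersection graph of closed disks $D_v$ with centers $(x_v,y_v)$ and radii $r_v$ ($v\in V(G)$) such that for every $v$, $x_v>0$, $y_v>0$ and $\max(x_v,y_v)\leq r_v<\sqrt{x_v^2+y_v^2}$.
   Formalization: The interval endpoints, the disk centers $(x_v,y_v)$ and the radii $r_v$ take values in ℚ rather than in the real numbers. -}

module Defs where

open import Data.Nat using (ℕ)
open import Data.Fin using (Fin)
open import Data.Product using (_×_; Σ)
open import Data.Rational using (ℚ; 0ℚ; _≤_; _<_; _+_; _-_; _*_)
open import Relation.Binary.PropositionalEquality using (_≡_; _≢_)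
open import Relation.Nullary using (¬_)
open import Function.Bundles using (_⇔_)

record Graph : Set₁ where
  field
    n      : ℕ
    Adj    : Fin n → Fin n → Set
    sym    : ∀ {u v} → Adj u v → Adj v u
    irrefl : ∀ {u} → ¬ Adj u u
open Graph public

record Interval : Set where
  constructor [_,_]⟨_⟩
  field
    lo hi : ℚ
    lo≤hi : lo ≤ hi
open Interval public

IntervalsMeet : Interval → Interval → Set
IntervalsMeet I J = (lo I ≤ hi J) × (lo J ≤ hi I)

IsIntervalGraph : Graph → Set
IsIntervalGraph G =
  Σ (Fin (n G) → Interval) λ I →
    ∀ (u v : Fin (n G)) → u ≢ v → Adj G u v ⇔ IntervalsMeet (I u) (I v)

record Disk : Set where
  constructor disk
  field
    x y r : ℚ
open Disk public

sq : ℚ → ℚ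
sq a = a * a

-- Closed disks (with nonnegative radii) meet iff the distance of the centers
-- is at most the sum of the radii (squared form, both sides nonnegative).
DisksMeet : Disk → Disk → Set
DisksMeet D E = sq (x D - x E) + sq (y D - y E) ≤ sq (r D + r E)

-- The Δ-condition: x > 0, y > 0 and max(x,y) ≤ r < sqrt(x²+y²)
-- (r > 0 here, so r < sqrt(x²+y²) ⟺ r² < x²+y²).
ΔDisk : Disk → Set
ΔDisk D = (0ℚ < x D) × (0ℚ < y D) × (x D ≤ r D) × (y D ≤ r D)
          × (sq (r D) < sq (x D) + sq (y D))

IsΔDiskGraph : Graph → Set
IsΔDiskGraph G =
  Σ (Fin (n G) → Disk) λ D →
    (∀ v → ΔDisk (D v)) ×
    (∀ (u v : Fin (n G)) → u ≢ v → Adj G u v ⇔ DisksMeet (D u) (D v))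

{-# OPTIONS --safe #-}
module Submission where

-- Disks centred on a common line meet exactly when their diameters on that line do.
-- So an interval [a, b] is sent to the disk centred on the ray through (3, 4) whose
-- diameter covers the distances 10a to 10b from the origin; this disk is a Δ-disk as
-- soon as 0 < a and 9a ≤ b. A finite family of intervals is moved into that range,
-- without changing which pairs meet, by replacing every endpoint with a power of 9
-- indexed by its rank among the right endpoints.
-- The 4-cycle is a Δ-disk graph, checked on four explicit disks, but not an interval
-- graph: the intervals of a non-adjacent pair leave a gap that both other intervals
-- must cover, so those two would meet.

open import Defs
open import Data.Product using (_×_; Σ; _,_; uncurry)
open import Relation.Nullary using (¬_)

open import Data.Bool as Bool using (Bool; true; false)
open import Data.Fin as Fin using (Fin; zero; suc; #_)
open import Data.Fin.Properties using (all?)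
open import Data.Integer using (+_)
open import Data.List using (List; []; _∷_; tabulate)
open import Data.List.Membership.Propositional using (_∈_)
open import Data.List.Membership.Propositional.Properties using (∈-tabulate⁺)
open import Data.List.Relation.Unary.Any using (here; there)
open import Data.Nat as ℕ using (ℕ; z≤n; s≤s; _≤′_; ≤′-refl; ≤′-step)
import Data.Nat.Properties as ℕ
open import Data.Product.Function.NonDependent.Propositional using (_×-⇔_)
open import Data.Rational
  using (ℚ; 0ℚ; 1ℚ; _≤_; _<_; _+_; _-_; _*_; -_; _/_; _≤?_; _<?_; Positive; positive; nonNegative)
open import Data.Rational.Properties
open import Data.Rational.Solver using (module +-*-Solver)
open import Data.Sum using (_⊎_; inj₁; inj₂)
open import Function using (_∘_)
open import Function.Bundles using (_⇔_; mk⇔; Equivalence)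
import Function.Properties.Equivalence as ⇔
open import Function.Related.Propositional using (module EquationalReasoning)
open import Relation.Binary.PropositionalEquality using (_≡_; _≢_; refl; subst; subst₂)
import Relation.Binary.PropositionalEquality as ≡
open import Relation.Nullary using (Dec; yes; no; contradiction; ¬?)
open import Relation.Nullary.Decidable using (from-yes; map′; _×-dec_; _→-dec_)

open +-*-Solver using (solve; _:+_; _:*_; _:-_; _:=_; con)
open Equivalence using (to; from)
open import Algebra.Definitions.RawSemiring +-*-rawSemiring using (_^_)

<⇒≱ : ∀ {p q} → p < q → ¬ q ≤ p
<⇒≱ p<q q≤p = <-irrefl refl (<-≤-trans p<q q≤p)

q-p+p≡q : ∀ p q → q - p + p ≡ q
q-p+p≡q = solve 2 (λ p q → q :- p :+ p := q) refl

0≤q-p⇔p≤q : ∀ {p q} → 0ℚ ≤ q - p ⇔ p ≤ q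
0≤q-p⇔p≤q {p} {q} = mk⇔
  (λ 0≤q-p → subst₂ _≤_ (+-identityˡ p) (q-p+p≡q p q) (+-monoˡ-≤ p 0≤q-p))
  (λ p≤q → subst (_≤ q - p) (+-inverseʳ p) (+-monoˡ-≤ (- p) p≤q))

0<q-p⇒p<q : ∀ {p q} → 0ℚ < q - p → p < q
0<q-p⇒p<q {p} {q} 0<q-p = subst₂ _<_ (+-identityˡ p) (q-p+p≡q p q) (+-monoˡ-< p 0<q-p)

0≤p+q⇒0≤p*q⇒0≤p : ∀ {p q} → 0ℚ ≤ p + q → 0ℚ ≤ p * q → 0ℚ ≤ p
0≤p+q⇒0≤p*q⇒0≤p {p} {q} 0≤p+q 0≤p*q with 0ℚ ≤? p | 0ℚ <? q
... | yes 0≤p | _       = 0≤p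
... | no 0≰p  | yes 0<q = contradiction 0≤p*q (<⇒≱ p*q<0)
  where
  p*q<0 : p * q < 0ℚ
  p*q<0 = subst (p * q <_) (*-zeroˡ q) (*-monoˡ-<-pos q {{positive 0<q}} (≰⇒> 0≰p))
... | no 0≰p  | no 0≮q  = contradiction 0≤p+q (<⇒≱ (+-mono-<-≤ (≰⇒> 0≰p) (≮⇒≥ 0≮q)))

0≤p+q⇒[0≤p*q⇔0≤p×0≤q] : ∀ {p q} → 0ℚ ≤ p + q → 0ℚ ≤ p * q ⇔ (0ℚ ≤ p × 0ℚ ≤ q)
0≤p+q⇒[0≤p*q⇔0≤p×0≤q] {p} {q} 0≤p+q = mk⇔
  (λ 0≤p*q → 0≤p+q⇒0≤p*q⇒0≤p 0≤p+q 0≤p*q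
           , 0≤p+q⇒0≤p*q⇒0≤p (subst (0ℚ ≤_) (+-comm p q) 0≤p+q)
                               (subst (0ℚ ≤_) (*-comm p q) 0≤p*q))
  (λ (0≤p , 0≤q) → subst (_≤ p * q) (*-zeroˡ q) (*-monoʳ-≤-nonNeg q {{nonNegative 0≤q}} 0≤p))

0≤c*p⇔0≤p : ∀ {p} c .{{_ : Positive c}} → 0ℚ ≤ c * p ⇔ 0ℚ ≤ p
0≤c*p⇔0≤p {p} c = mk⇔
  (λ 0≤c*p → *-cancelˡ-≤-pos c (subst (_≤ c * p) (≡.sym (*-zeroʳ c)) 0≤c*p))
  (λ 0≤p → subst (_≤ c * p) (*-zeroʳ c) (*-monoˡ-≤-nonNeg c {{pos⇒nonNeg c}} 0≤p))

0<c*p : ∀ {p} c .{{_ : Positive c}} → 0ℚ < p → 0ℚ < c * p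
0<c*p c 0<p = subst (_< c * _) (*-zeroʳ c) (*-monoʳ-<-pos c 0<p)

diskOfInterval : Interval → Disk
diskOfInterval I =
  disk (+ 3 / 1 * (lo I + hi I)) (+ 4 / 1 * (lo I + hi I)) (+ 5 / 1 * (hi I - lo I))

diskOfInterval-overlap : ∀ I J →
  let D = diskOfInterval I; E = diskOfInterval J in
  sq (r D + r E) - (sq (x D - x E) + sq (y D - y E)) ≡ + 100 / 1 * ((hi J - lo I) * (hi I - lo J))
diskOfInterval-overlap I J = solve 4
  (λ a b c d →
    let x₁ = con (+ 3 / 1) :* (a :+ b); y₁ = con (+ 4 / 1) :* (a :+ b); r₁ = con (+ 5 / 1) :* (b :- a)
        x₂ = con (+ 3 / 1) :* (c :+ d); y₂ = con (+ 4 / 1) :* (c :+ d); r₂ = con (+ 5 / 1) :* (d :- c)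
    in  (r₁ :+ r₂) :* (r₁ :+ r₂) :- ((x₁ :- x₂) :* (x₁ :- x₂) :+ (y₁ :- y₂) :* (y₁ :- y₂))
        := con (+ 100 / 1) :* ((d :- a) :* (b :- c)))
  refl (lo I) (hi I) (lo J) (hi J)

diskOfInterval-meet⇔ : ∀ I J → IntervalsMeet I J ⇔ DisksMeet (diskOfInterval I) (diskOfInterval J)
diskOfInterval-meet⇔ I J = begin
  IntervalsMeet I J                            ∼⟨ ⇔.sym (0≤q-p⇔p≤q ×-⇔ 0≤q-p⇔p≤q) ⟩
  (0ℚ ≤ hi J - lo I × 0ℚ ≤ hi I - lo J)        ∼⟨ ⇔.sym (0≤p+q⇒[0≤p*q⇔0≤p×0≤q] 0≤gaps) ⟩
  0ℚ ≤ (hi J - lo I) * (hi I - lo J)           ∼⟨ ⇔.sym (0≤c*p⇔0≤p (+ 100 / 1)) ⟩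
  0ℚ ≤ + 100 / 1 * ((hi J - lo I) * (hi I - lo J))
                                               ≡⟨ ≡.cong (0ℚ ≤_) (diskOfInterval-overlap I J) ⟨
  0ℚ ≤ sq (r D + r E) - (sq (x D - x E) + sq (y D - y E))
                                               ∼⟨ 0≤q-p⇔p≤q ⟩
  DisksMeet D E                                ∎
  where
  open EquationalReasoning
  D E : Disk
  D = diskOfInterval I
  E = diskOfInterval J
  0≤gaps : 0ℚ ≤ (hi J - lo I) + (hi I - lo J)
  0≤gaps = subst (0ℚ ≤_)
    (solve 4 (λ a b c d → (b :- a) :+ (d :- c) := (d :- a) :+ (b :- c)) refl (lo I) (hi I) (lo J) (hi J))
    (+-mono-≤ (from 0≤q-p⇔p≤q (lo≤hi I)) (from 0≤q-p⇔p≤q (lo≤hi J)))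

diskOfInterval-Δ : ∀ I → 0ℚ < lo I → + 9 / 1 * lo I ≤ hi I → ΔDisk (diskOfInterval I)
diskOfInterval-Δ I 0<a 9a≤b =
  0<c*p (+ 3 / 1) 0<a+b , 0<c*p (+ 4 / 1) 0<a+b , ≤-trans x≤y y≤r , y≤r , r²<x²+y²
  where
  D : Disk
  D = diskOfInterval I
  0<b : 0ℚ < hi I
  0<b = <-≤-trans 0<a (lo≤hi I)
  0<a+b : 0ℚ < lo I + hi I
  0<a+b = +-mono-< 0<a 0<b
  x≤y : x D ≤ y D
  x≤y = *-monoʳ-≤-nonNeg (lo I + hi I) {{nonNegative (<⇒≤ 0<a+b)}} (from-yes (+ 3 / 1 ≤? + 4 / 1))
  y≤r : y D ≤ r D
  y≤r = to 0≤q-p⇔p≤q (subst (0ℚ ≤_)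
    (solve 2 (λ a b → b :- con (+ 9 / 1) :* a := con (+ 5 / 1) :* (b :- a) :- con (+ 4 / 1) :* (a :+ b))
       refl (lo I) (hi I))
    (from 0≤q-p⇔p≤q 9a≤b))
  r²<x²+y² : sq (r D) < sq (x D) + sq (y D)
  r²<x²+y² = 0<q-p⇒p<q (subst (0ℚ <_)
    (solve 2 (λ a b →
       let x = con (+ 3 / 1) :* (a :+ b); y = con (+ 4 / 1) :* (a :+ b); r = con (+ 5 / 1) :* (b :- a)
       in  con (+ 100 / 1) :* (a :* b) := x :* x :+ y :* y :- r :* r)
     refl (lo I) (hi I))
    (0<c*p (+ 100 / 1) (0<c*p (lo I) {{positive 0<a}} 0<b)))

rank : List ℚ → ℚ → ℕ
rank []       t = 0
rank (h ∷ hs) t with h <? t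
... | yes _ = ℕ.suc (rank hs t)
... | no _  = rank hs t

rank-mono : ∀ {t t′} hs → t ≤ t′ → rank hs t ℕ.≤ rank hs t′
rank-mono [] t≤t′ = z≤n
rank-mono {t} {t′} (h ∷ hs) t≤t′ with h <? t | h <? t′
... | yes _   | yes _    = s≤s (rank-mono hs t≤t′)
... | yes h<t | no h≮t′ = contradiction (<-≤-trans h<t t≤t′) h≮t′
... | no _    | yes _    = ℕ.m≤n⇒m≤1+n (rank-mono hs t≤t′)
... | no _    | no _     = rank-mono hs t≤t′

rank-strict : ∀ {h t} hs → h ∈ hs → h < t → rank hs h ℕ.< rank hs t
rank-strict {h} {t} (h ∷ hs) (here refl) h<t with h <? h | h <? t
... | yes h<h | _        = contradiction h<h (<-irrefl refl)
... | no _    | yes _    = s≤s (rank-mono hs (<⇒≤ h<t))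
... | no _    | no h≮t  = contradiction h<t h≮t
rank-strict {h} {t} (h′ ∷ hs) (there h∈hs) h<t with h′ <? h | h′ <? t
... | yes _    | yes _     = s≤s (rank-strict hs h∈hs h<t)
... | yes h′<h | no h′≮t  = contradiction (<-trans h′<h h<t) h′≮t
... | no _     | yes _     = ℕ.m<n⇒m<1+n (rank-strict hs h∈hs h<t)
... | no _     | no _      = rank-strict hs h∈hs h<t

≤⇔rank≤rank : ∀ {h t} hs → h ∈ hs → t ≤ h ⇔ rank hs t ℕ.≤ rank hs h
≤⇔rank≤rank hs h∈hs = mk⇔ (rank-mono hs)
  (λ ρt≤ρh → ≮⇒≥ (λ h<t → ℕ.<⇒≱ (rank-strict hs h∈hs h<t) ρt≤ρh))

module _ {c : ℚ} (1<c : 1ℚ < c) where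

  0<c^k : ∀ k → 0ℚ < c ^ k
  0<c^k ℕ.zero    = from-yes (0ℚ <? 1ℚ)
  0<c^k (ℕ.suc k) = 0<c*p c {{positive (<-trans (from-yes (0ℚ <? 1ℚ)) 1<c)}} (0<c^k k)

  c^k<c^[1+k] : ∀ k → c ^ k < c ^ ℕ.suc k
  c^k<c^[1+k] k =
    subst (_< c * c ^ k) (*-identityˡ (c ^ k)) (*-monoˡ-<-pos (c ^ k) {{positive (0<c^k k)}} 1<c)

  ^-monoʳ-≤′ : ∀ {j k} → j ≤′ k → c ^ j ≤ c ^ k
  ^-monoʳ-≤′ ≤′-refl          = ≤-refl
  ^-monoʳ-≤′ (≤′-step {k} j≤k) = ≤-trans (^-monoʳ-≤′ j≤k) (<⇒≤ (c^k<c^[1+k] k))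

  ^-monoʳ-< : ∀ {j k} → j ℕ.< k → c ^ j < c ^ k
  ^-monoʳ-< {j} j<k = <-≤-trans (c^k<c^[1+k] j) (^-monoʳ-≤′ (ℕ.≤⇒≤′ j<k))

  ≤⇔^≤^ : ∀ {j k} → j ℕ.≤ k ⇔ c ^ j ≤ c ^ k
  ≤⇔^≤^ = mk⇔ (^-monoʳ-≤′ ∘ ℕ.≤⇒≤′) (λ c^j≤c^k → ℕ.≮⇒≥ (λ k<j → <⇒≱ (^-monoʳ-< k<j) c^j≤c^k))

≤⇔2*≤1+2* : ∀ {j k} → j ℕ.≤ k ⇔ 2 ℕ.* j ℕ.≤ ℕ.suc (2 ℕ.* k)
≤⇔2*≤1+2* {j} {k} = mk⇔ (ℕ.m≤n⇒m≤1+n ∘ ℕ.*-monoʳ-≤ 2)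
  (λ 2j≤1+2k → ℕ.≮⇒≥ λ k<j →
     ℕ.<⇒≱ (subst (ℕ._≤ 2 ℕ.* j) (ℕ.*-suc 2 k) (ℕ.*-monoʳ-≤ 2 k<j)) 2j≤1+2k)

1<9 : 1ℚ < + 9 / 1
1<9 = from-yes (1ℚ <? + 9 / 1)

module _ {m} (I : Fin m → Interval) where

  private
    rightEnds : List ℚ
    rightEnds = tabulate (hi ∘ I)

    ρ : ℚ → ℕ
    ρ = rank rightEnds

  -- Left endpoints get even and right endpoints odd exponents, so that hi / lo ≥ 9
  -- while the order between left and right endpoints is kept.
  spread : Fin m → Interval
  spread u = [ (+ 9 / 1) ^ (2 ℕ.* ρ (lo (I u))) , (+ 9 / 1) ^ ℕ.suc (2 ℕ.* ρ (hi (I u)))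
             ]⟨ to (≤⇔^≤^ 1<9) (to ≤⇔2*≤1+2* (rank-mono rightEnds (lo≤hi (I u)))) ⟩

  0<lo-spread : ∀ u → 0ℚ < lo (spread u)
  0<lo-spread u = 0<c^k 1<9 (2 ℕ.* ρ (lo (I u)))

  9*lo≤hi-spread : ∀ u → + 9 / 1 * lo (spread u) ≤ hi (spread u)
  9*lo≤hi-spread u = to (≤⇔^≤^ 1<9) (s≤s (ℕ.*-monoʳ-≤ 2 (rank-mono rightEnds (lo≤hi (I u)))))

  lo≤hi⇔spread : ∀ u v → lo (I u) ≤ hi (I v) ⇔ lo (spread u) ≤ hi (spread v)
  lo≤hi⇔spread u v =
    ⇔.trans (≤⇔rank≤rank rightEnds (∈-tabulate⁺ v)) (⇔.trans ≤⇔2*≤1+2* (≤⇔^≤^ 1<9))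

  spread-meet⇔ : ∀ u v → IntervalsMeet (I u) (I v) ⇔ IntervalsMeet (spread u) (spread v)
  spread-meet⇔ u v = lo≤hi⇔spread u v ×-⇔ lo≤hi⇔spread v u

intervalGraph⇒ΔDiskGraph : ∀ G → IsIntervalGraph G → IsΔDiskGraph G
intervalGraph⇒ΔDiskGraph G (I , I-represents) =
    diskOfInterval ∘ spread I
  , (λ v → diskOfInterval-Δ (spread I v) (0<lo-spread I v) (9*lo≤hi-spread I v))
  , λ u v u≢v → ⇔.trans (I-represents u v u≢v)
                  (⇔.trans (spread-meet⇔ I u v) (diskOfInterval-meet⇔ (spread I u) (spread I v)))

¬meet⇒separated : ∀ I J → ¬ IntervalsMeet I J → hi I < lo J ⊎ hi J < lo I
¬meet⇒separated I J ¬meet with lo J ≤? hi I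
... | no loJ≰hiI  = inj₁ (≰⇒> loJ≰hiI)
... | yes loJ≤hiI = inj₂ (≰⇒> (λ loI≤hiJ → ¬meet (loI≤hiJ , loJ≤hiI)))

meets-across⇒contains : ∀ I J K → hi I < lo J → IntervalsMeet K I → IntervalsMeet K J →
                        lo K ≤ hi I × hi I ≤ hi K
meets-across⇒contains I J K hiI<loJ (loK≤hiI , _) (_ , loJ≤hiK) =
  loK≤hiI , ≤-trans (<⇒≤ hiI<loJ) loJ≤hiK

contain-common⇒meet : ∀ {t} K L → lo K ≤ t × t ≤ hi K → lo L ≤ t × t ≤ hi L → IntervalsMeet K L
contain-common⇒meet K L (loK≤t , t≤hiK) (loL≤t , t≤hiL) = ≤-trans loK≤t t≤hiL , ≤-trans loL≤t t≤hiK

meet-both-of-disjoint⇒meet : ∀ I J K L → ¬ IntervalsMeet I J →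
  IntervalsMeet K I → IntervalsMeet K J → IntervalsMeet L I → IntervalsMeet L J → IntervalsMeet K L
meet-both-of-disjoint⇒meet I J K L ¬meet KI KJ LI LJ with ¬meet⇒separated I J ¬meet
... | inj₁ hiI<loJ = contain-common⇒meet K L (meets-across⇒contains I J K hiI<loJ KI KJ)
                                             (meets-across⇒contains I J L hiI<loJ LI LJ)
... | inj₂ hiJ<loI = contain-common⇒meet K L (meets-across⇒contains J I K hiJ<loI KJ KI)
                                             (meets-across⇒contains J I L hiJ<loI LJ LI)

side : Fin 4 → Bool
side zero                   = false
side (suc zero)             = true
side (suc (suc zero))       = false
side (suc (suc (suc zero))) = true

C₄ : Graph
C₄ = record
  { n      = 4
  ; Adj    = λ u v → side u ≢ side v
  ; sym    = λ side-u≢side-v → side-u≢side-v ∘ ≡.sym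
  ; irrefl = λ side-u≢side-u → side-u≢side-u refl
  }

C₄-not-interval : ¬ IsIntervalGraph C₄
C₄-not-interval (I , I-represents) =
  apart (# 1) (# 3) (λ ()) refl
    (meet-both-of-disjoint⇒meet (I (# 0)) (I (# 2)) (I (# 1)) (I (# 3))
      (apart (# 0) (# 2) (λ ()) refl)
      (meet (# 1) (# 0) (λ ()) (λ ())) (meet (# 1) (# 2) (λ ()) (λ ()))
      (meet (# 3) (# 0) (λ ()) (λ ())) (meet (# 3) (# 2) (λ ()) (λ ())))
  where
  meet : ∀ u v → u ≢ v → side u ≢ side v → IntervalsMeet (I u) (I v)
  meet u v u≢v = to (I-represents u v u≢v)
  apart : ∀ u v → u ≢ v → side u ≡ side v → ¬ IntervalsMeet (I u) (I v)
  apart u v u≢v same-side uv-meet = from (I-represents u v u≢v) uv-meet same-side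

_⇔-dec_ : {A B : Set} → Dec A → Dec B → Dec (A ⇔ B)
a? ⇔-dec b? = map′ (uncurry mk⇔) (λ A⇔B → to A⇔B , from A⇔B) ((a? →-dec b?) ×-dec (b? →-dec a?))

disksMeet? : ∀ D E → Dec (DisksMeet D E)
disksMeet? D E = _ ≤? _

ΔDisk? : ∀ D → Dec (ΔDisk D)
ΔDisk? D = 0ℚ <? x D ×-dec 0ℚ <? y D ×-dec x D ≤? r D ×-dec y D ≤? r D
           ×-dec sq (r D) <? sq (x D) + sq (y D)

-- Each small disk misses the large disk across the diagonal only narrowly:
-- the squared distance of their centres is 290 > (2 + 15)².
C₄-disk : Fin 4 → Disk
C₄-disk zero                   = disk (+ 1 / 1) (+ 2 / 1) (+ 2 / 1)
C₄-disk (suc zero)             = disk (+ 13 / 1) (+ 14 / 1) (+ 15 / 1)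
C₄-disk (suc (suc zero))       = disk (+ 14 / 1) (+ 13 / 1) (+ 15 / 1)
C₄-disk (suc (suc (suc zero))) = disk (+ 2 / 1) (+ 1 / 1) (+ 2 / 1)

C₄-ΔDisk : IsΔDiskGraph C₄
C₄-ΔDisk =
    C₄-disk
  , from-yes (all? (ΔDisk? ∘ C₄-disk))
  , from-yes (all? λ u → all? λ v →
      ¬? (u Fin.≟ v) →-dec (¬? (side u Bool.≟ side v) ⇔-dec disksMeet? (C₄-disk u) (C₄-disk v)))

theorem18 : ((G : Graph) → IsIntervalGraph G → IsΔDiskGraph G)
            × Σ Graph (λ G → IsΔDiskGraph G × ¬ IsIntervalGraph G)
theorem18 = intervalGraph⇒ΔDiskGraph , C₄ , C₄-ΔDisk , C₄-not-interval
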